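{- Let $\ell\ge2$ be an integer and let $L(p)$ be an integer-valued function of $p$ with $L(p)\to\infty$ as $p\to\infty$. Then for every $\ell$-th root of unity $\mu$ and for all $x_0\in[0,p-1]$ except possibly $O(p/L(p)^{1/7})$ of them, there is an integer $x$ in the interval $[x_0,x_0+L(p))$ with $\left(\frac{x}{p}\right)_\ell=\mu$.
   Context: $p$ denotes a (large) prime and $\left(\frac{\cdot}{p}\right)_\ell$ denotes the $\ell$-th power residue symbol modulo $p$ (a multiplicative character of order $\ell$ on $\mathbb{F}_p^*$, taking values in the $\ell$-th roots of unity). Asymptotics are as $p\to\infty$. -}

module Defs where

open import Data.Nat using (ℕ; _+_; _^_; _∸_; _/_; _%_; NonZero)
open import Data.Nat.Properties using (_≟_)
open import Data.Integer using (ℤ; +_; -[1+_])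
open import Data.List using (List; upTo; filter; length; map)
open import Data.List.Relation.Unary.Any using (Any; any?)
open import Relation.Binary.PropositionalEquality using (_≡_)
open import Relation.Nullary using (¬_; ¬?)

-- ℓ-th power residue symbol modulo p (for ℓ ∣ p - 1), computed in 𝔽_p:
-- (x/p)_ℓ ≡ x^((p-1)/ℓ)  (mod p).  Its values on units are the ℓ-th roots
-- of unity of 𝔽_p, which correspond bijectively to the complex ℓ-th roots
-- of unity (the symbol is defined through exactly this reduction); the
-- value 0 (for p ∣ x) is not a root of unity.
powerResidue : (p ℓ : ℕ) → .{{_ : NonZero p}} → .{{_ : NonZero ℓ}} → ℕ → ℕ
powerResidue p ℓ x = (x ^ ((p ∸ 1) / ℓ)) % p

len : ℤ → ℕ
len (+ n) = n
len -[1+ _ ] = 0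

hitsWindow : (p ℓ : ℕ) → .{{_ : NonZero p}} → .{{_ : NonZero ℓ}} →
             (r : ℕ) (L : ℤ) (x₀ : ℕ) → Set
hitsWindow p ℓ r L x₀ = Any (λ i → powerResidue p ℓ (x₀ + i) ≡ r) (upTo (len L))

exceptional : (p ℓ : ℕ) → .{{_ : NonZero p}} → .{{_ : NonZero ℓ}} →
              (r : ℕ) (L : ℤ) → ℕ
exceptional p ℓ r L =
  length (filter (λ x₀ → ¬? (any? (λ i → powerResidue p ℓ (x₀ + i) ≟ r) (upTo (len L))))
                 (upTo p))

{-# OPTIONS --safe #-}
-- Let χ(x) = x^k mod p with k = (p - 1)/ℓ, let S be the number of x with χ(x) = r, and let
-- G(x) = p·[χ(x) = r] - S, which has mean zero. Then S ≥ k: by Fermat, every nonzero x outside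
-- the fibre of r is a root of (x^(p-1) - r^ℓ)/(x^k - r), which has degree k(ℓ - 1).
-- For the progression sums W(a, b) = Σ_{i<L} G(a + b i) with L ≤ p, averaging over all a and b
-- kills the cross terms, so Σ_{a,b} W(a, b)² = L p Σ_x G(x)² ≤ L p³ S. Since χ(b x) = χ(x) when
-- χ(b) = 1, each of the ≥ k such b contributes Σ_a W(a, 1)², and every x₀ whose window
-- [x₀, x₀ + L) misses r contributes W(x₀, 1)² = L² S². Hence k E L² S² ≤ L p³ S for the number E
-- of such x₀, i.e. E L ≤ p³/k² ≤ 4 ℓ² p, and E⁷ L ≤ (4 ℓ²)⁷ p⁷ because E ≤ p.
-- Windows longer than p never miss r.
module Submission where

open import Algebra.Bundles using (CommutativeMonoid)
open import Data.Nat.Base using (ℕ; zero; suc; _<_; _∸_; z≤n; s≤s; NonZero)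
import Data.Nat.Base as Nat
open import Data.Nat.Divisibility using (_∣_)
open import Data.Nat.Primality using (Prime)
open import Data.Integer.Base using (ℤ; 0ℤ)
open import Relation.Binary.PropositionalEquality as ≡ using (_≡_)
open import Defs

record InverseBelow (n : ℕ) (σ τ : ℕ → ℕ) : Set where
  field
    σ-< : ∀ {x} → x < n → σ x < n
    τ-< : ∀ {x} → x < n → τ x < n
    τ∘σ : ∀ {x} → x < n → τ (σ x) ≡ x
    σ∘τ : ∀ {x} → x < n → σ (τ x) ≡ x

module BigOperator {c ℓ} (M : CommutativeMonoid c ℓ) where
  open CommutativeMonoid M
  open import Data.Fin.Base using (Fin; toℕ; fromℕ<)
  open import Data.Fin.Properties using (toℕ<n; toℕ-fromℕ<; toℕ-injective)
  open import Data.Fin.Permutation using (Permutation; permutation; _⟨$⟩ʳ_)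
  open import Algebra.Properties.CommutativeMonoid.Sum M using (sum; sum-cong-≗; ∑-permute)
  open import Relation.Binary.Reasoning.Setoid setoid

  ⨁ : ℕ → (ℕ → Carrier) → Carrier
  ⨁ n f = sum {n} (λ i → f (toℕ i))

  ⨁-cong : ∀ n {f g : ℕ → Carrier} → (∀ {i} → i < n → f i ≈ g i) → ⨁ n f ≈ ⨁ n g
  ⨁-cong zero    f≈g = refl
  ⨁-cong (suc n) f≈g = ∙-cong (f≈g (s≤s z≤n)) (⨁-cong n (λ i<n → f≈g (s≤s i<n)))

  ⨁-permute : ∀ n (f : ℕ → Carrier) {σ τ : ℕ → ℕ} → InverseBelow n σ τ →
              ⨁ n (λ x → f (σ x)) ≈ ⨁ n f
  ⨁-permute n f {σ} {τ} inv = begin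
    ⨁ n (λ x → f (σ x))              ≡⟨ sum-cong-≗ (λ i → ≡.cong f (≡.sym (toℕ-fromℕ< (σ-< (toℕ<n i))))) ⟩
    sum (λ i → f (toℕ (π ⟨$⟩ʳ i)))   ≈⟨ sym (∑-permute (λ i → f (toℕ i)) π) ⟩
    ⨁ n f                            ∎
    where
    open InverseBelow inv
    σ′ τ′ : Fin n → Fin n
    σ′ i = fromℕ< (σ-< (toℕ<n i))
    τ′ i = fromℕ< (τ-< (toℕ<n i))
    π : Permutation n n
    π = permutation σ′ τ′
          (λ i → toℕ-injective (≡.trans (toℕ-fromℕ< _) (≡.trans (≡.cong σ (toℕ-fromℕ< _)) (σ∘τ (toℕ<n i)))))
          (λ i → toℕ-injective (≡.trans (toℕ-fromℕ< _) (≡.trans (≡.cong τ (toℕ-fromℕ< _)) (τ∘σ (toℕ<n i)))))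

module IntegerSum where
  open import Data.Integer hiding (suc; _<_)
  open import Data.Integer.Properties
  open import Data.Integer.Solver using (module +-*-Solver)
  open +-*-Solver
  open import Data.Bool using (if_then_else_; true; false)
  open import Data.Empty using (⊥-elim)
  open import Data.List using (filter; applyUpTo; length)
  open import Data.Sum using (_⊎_; inj₁; inj₂)
  open import Relation.Nullary using (Dec; yes; no; does; ¬_)
  open import Relation.Unary using (Pred; Decidable)
  import Data.Nat.Properties as Nat
  open import Data.Nat.Base using () renaming (_≤_ to _≤ℕ_)
  open ≡ using (refl; cong; cong₂; trans; sym)

  open BigOperator +-0-commutativeMonoid public
    using () renaming (⨁ to ∑; ⨁-cong to ∑-cong; ⨁-permute to ∑-permute)

  ∑-zero : ∀ n {f : ℕ → ℤ} → (∀ {i} → i < n → f i ≡ 0ℤ) → ∑ n f ≡ 0ℤ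
  ∑-zero zero    f≡0 = refl
  ∑-zero (suc n) f≡0 = cong₂ _+_ (f≡0 (s≤s z≤n)) (∑-zero n (λ i<n → f≡0 (s≤s i<n)))

  ∑-const : ∀ n c → ∑ n (λ _ → c) ≡ + n * c
  ∑-const zero    c = sym (*-zeroˡ c)
  ∑-const (suc n) c = trans (cong (_+_ c) (∑-const n c))
                            (solve 2 (λ c n → c :+ n :* c := (con 1ℤ :+ n) :* c) refl c (+ n))

  ∑-mono-≤ : ∀ n {f g : ℕ → ℤ} → (∀ {i} → i < n → f i ≤ g i) → ∑ n f ≤ ∑ n g
  ∑-mono-≤ zero    f≤g = ≤-refl
  ∑-mono-≤ (suc n) f≤g = +-mono-≤ (f≤g (s≤s z≤n)) (∑-mono-≤ n (λ i<n → f≤g (s≤s i<n)))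

  ∑-nonNeg : ∀ n {f : ℕ → ℤ} → (∀ {i} → i < n → 0ℤ ≤ f i) → 0ℤ ≤ ∑ n f
  ∑-nonNeg zero    f≥0 = ≤-refl
  ∑-nonNeg (suc n) f≥0 = +-mono-≤ (f≥0 (s≤s z≤n)) (∑-nonNeg n (λ i<n → f≥0 (s≤s i<n)))

  ∑-distrib-+ : ∀ n (f g : ℕ → ℤ) → ∑ n (λ i → f i + g i) ≡ ∑ n f + ∑ n g
  ∑-distrib-+ zero    f g = refl
  ∑-distrib-+ (suc n) f g =
    trans (cong (_+_ (f 0 + g 0)) (∑-distrib-+ n (λ i → f (suc i)) (λ i → g (suc i))))
          (solve 4 (λ a b c d → (a :+ b) :+ (c :+ d) := (a :+ c) :+ (b :+ d)) refl (f 0) (g 0) _ _)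

  ∑-distribˡ-* : ∀ n c (f : ℕ → ℤ) → ∑ n (λ i → c * f i) ≡ c * ∑ n f
  ∑-distribˡ-* zero    c f = sym (*-zeroʳ c)
  ∑-distribˡ-* (suc n) c f =
    trans (cong (_+_ (c * f 0)) (∑-distribˡ-* n c (λ i → f (suc i)))) (sym (*-distribˡ-+ c (f 0) _))

  ∑-distribʳ-* : ∀ n c (f : ℕ → ℤ) → ∑ n (λ i → f i * c) ≡ ∑ n f * c
  ∑-distribʳ-* n c f =
    trans (∑-cong n (λ {i} _ → *-comm (f i) c)) (trans (∑-distribˡ-* n c f) (*-comm c _))

  ∑-comm : ∀ m n (f : ℕ → ℕ → ℤ) → ∑ m (λ i → ∑ n (f i)) ≡ ∑ n (λ j → ∑ m (λ i → f i j))
  ∑-comm zero    n f = sym (∑-zero n (λ _ → refl))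
  ∑-comm (suc m) n f = trans (cong (_+_ (∑ n (f 0))) (∑-comm m n (λ i → f (suc i))))
                             (sym (∑-distrib-+ n (f 0) (λ j → ∑ m (λ i → f (suc i) j))))

  ∑-square : ∀ n (f : ℕ → ℤ) → ∑ n f * ∑ n f ≡ ∑ n (λ i → ∑ n (λ j → f i * f j))
  ∑-square n f = trans (sym (∑-distribʳ-* n (∑ n f) f)) (∑-cong n (λ {i} _ → sym (∑-distribˡ-* n (f i) f)))

  +-cancelˡ-≤ : ∀ i {j k} → i + j ≤ i + k → j ≤ k
  +-cancelˡ-≤ i {j} {k} i+j≤i+k = ≡.subst₂ _≤_ (-i+[i+x]≡x j) (-i+[i+x]≡x k) (+-monoʳ-≤ (- i) i+j≤i+k)
    where
    -i+[i+x]≡x : ∀ x → - i + (i + x) ≡ x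
    -i+[i+x]≡x x = solve 2 (λ i x → :- i :+ (i :+ x) := x) refl i x

  +≤⇒≤∣∣ : ∀ {n i} → + n ≤ i → n ≤ℕ ∣ i ∣
  +≤⇒≤∣∣ (+≤+ n≤m) = n≤m

  i*i≥0 : ∀ i → 0ℤ ≤ i * i
  i*i≥0 +0       = +≤+ z≤n
  i*i≥0 +[1+ n ] = +≤+ z≤n
  i*i≥0 -[1+ n ] = +≤+ z≤n

  𝟙 : ∀ {a} {A : Set a} → Dec A → ℤ
  𝟙 d = if does d then 1ℤ else 0ℤ

  𝟙-yes : ∀ {a} {A : Set a} (d : Dec A) → A → 𝟙 d ≡ 1ℤ
  𝟙-yes (yes _) _ = refl
  𝟙-yes (no ¬a) a = ⊥-elim (¬a a)

  𝟙-no : ∀ {a} {A : Set a} (d : Dec A) → ¬ A → 𝟙 d ≡ 0ℤ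
  𝟙-no (yes a) ¬a = ⊥-elim (¬a a)
  𝟙-no (no _)  _  = refl

  𝟙≥0 : ∀ {a} {A : Set a} (d : Dec A) → 0ℤ ≤ 𝟙 d
  𝟙≥0 (yes _) = +≤+ z≤n
  𝟙≥0 (no _)  = ≤-refl

  𝟙*𝟙 : ∀ {a} {A : Set a} (d : Dec A) → 𝟙 d * 𝟙 d ≡ 𝟙 d
  𝟙*𝟙 (yes _) = refl
  𝟙*𝟙 (no _)  = refl

  𝟙-⊎ : ∀ {a b c} {A : Set a} {B : Set b} {C : Set c} (dA : Dec A) (dB : Dec B) (dC : Dec C) →
        (A → B ⊎ C) → 𝟙 dA ≤ 𝟙 dB + 𝟙 dC
  𝟙-⊎ (no _)  dB      dC      _     = +-mono-≤ (𝟙≥0 dB) (𝟙≥0 dC)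
  𝟙-⊎ (yes a) (yes _) dC      _     = i≤i+j 1ℤ (𝟙 dC) {{nonNegative (𝟙≥0 dC)}}
  𝟙-⊎ (yes _) (no _)  (yes _) _     = ≤-refl
  𝟙-⊎ (yes a) (no ¬b) (no ¬c) a→b∨c with a→b∨c a
  ... | inj₁ b = ⊥-elim (¬b b)
  ... | inj₂ c = ⊥-elim (¬c c)

  ∑-𝟙-≡-≤1 : ∀ n a → ∑ n (λ x → 𝟙 (x Nat.≟ a)) ≤ 1ℤ
  ∑-𝟙-≡-≤1 zero    a       = +≤+ z≤n
  ∑-𝟙-≡-≤1 (suc n) zero    = ≤-reflexive (cong (_+_ 1ℤ) (∑-zero n (λ _ → refl)))
  ∑-𝟙-≡-≤1 (suc n) (suc a) = ≤-trans (≤-reflexive (+-identityˡ _)) (∑-𝟙-≡-≤1 n a)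

  length-filter≡∑𝟙 : ∀ {p} {P : Pred ℕ p} (P? : Decidable P) (f : ℕ → ℕ) n →
                     + length (filter P? (applyUpTo f n)) ≡ ∑ n (λ i → 𝟙 (P? (f i)))
  length-filter≡∑𝟙 P? f zero = refl
  length-filter≡∑𝟙 P? f (suc n) with does (P? (f 0))
  ... | true  = cong (_+_ 1ℤ) (length-filter≡∑𝟙 P? (λ i → f (suc i)) n)
  ... | false = trans (length-filter≡∑𝟙 P? (λ i → f (suc i)) n) (sym (+-identityˡ _))

module NaturalProduct where
  open import Data.Nat.Base using (_*_; _^_)
  open import Data.Nat.Properties using (*-1-commutativeMonoid)
  open import Data.Nat.Solver using (module +-*-Solver)
  open +-*-Solver
  open ≡ using (refl; cong; trans)

  open BigOperator *-1-commutativeMonoid public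
    using () renaming (⨁ to ∏; ⨁-cong to ∏-cong; ⨁-permute to ∏-permute)

  ∏-scale : ∀ n a (f : ℕ → ℕ) → ∏ n (λ i → a * f i) ≡ a ^ n * ∏ n f
  ∏-scale zero    a f = refl
  ∏-scale (suc n) a f = trans (cong (a * f 0 *_) (∏-scale n a (λ i → f (suc i))))
    (solve 4 (λ a b c d → (a :* b) :* (c :* d) := (a :* c) :* (b :* d)) refl a (f 0) (a ^ n) (∏ n (λ i → f (suc i))))

module PowerLaws where
  open import Data.Nat.Base using (_*_; _^_)
  import Data.Integer.Base as ℤ
  import Data.Integer.Properties as ℤ
  open import Data.Nat.Solver using (module +-*-Solver)
  open +-*-Solver
  open ≡ using (refl; cong; trans)

  ^-distribʳ-* : ∀ a b n → (a * b) ^ n ≡ a ^ n * b ^ n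
  ^-distribʳ-* a b zero    = refl
  ^-distribʳ-* a b (suc n) = trans (cong (a * b *_) (^-distribʳ-* a b n))
    (solve 4 (λ a b x y → (a :* b) :* (x :* y) := (a :* x) :* (b :* y)) refl a b (a ^ n) (b ^ n))

  pos-^ : ∀ x n → ℤ.+ (x ^ n) ≡ (ℤ.+ x) ℤ.^ n
  pos-^ x zero    = refl
  pos-^ x (suc n) = trans (ℤ.pos-* x (x ^ n)) (cong (ℤ.+ x ℤ.*_) (pos-^ x n))

module Congruence (p : ℕ) .{{_ : NonZero p}} where
  open import Data.Nat.Base using (_+_; _*_; _∸_; _^_; _≤_; _%_; _/_)
  import Data.Nat.Properties as Nat
  open import Data.Nat.DivMod
  open import Data.Nat.Divisibility using (_∣_; divides; m%n≡0⇒n∣m; n∣m⇒m%n≡0)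
  open import Data.Integer.Base as ℤ using (+_; _⊖_; ∣_∣)
  import Data.Integer.Properties as ℤ
  import Data.Integer.Divisibility as ℤ
  open import Data.Sum using (inj₁; inj₂)
  open import Relation.Binary.Bundles using (Setoid)
  import Relation.Binary.Construct.On as On
  open ≡ using (refl; cong; cong₂; sym; trans)

  setoid : Setoid _ _
  setoid = On.setoid (≡.setoid ℕ) (_% p)

  open Setoid setoid public using (_≈_)
    renaming (refl to ≈-refl; sym to ≈-sym; trans to ≈-trans; reflexive to ≈-reflexive)

  %-≈ : ∀ a → a % p ≈ a
  %-≈ a = m%n%n≡m%n a p

  +-cong : ∀ {a b c d} → a ≈ b → c ≈ d → a + c ≈ b + d
  +-cong {a} {b} {c} {d} a≈b c≈d =
    trans (%-distribˡ-+ a c p) (trans (cong₂ (λ x y → (x + y) % p) a≈b c≈d) (sym (%-distribˡ-+ b d p)))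

  *-cong : ∀ {a b c d} → a ≈ b → c ≈ d → a * c ≈ b * d
  *-cong {a} {b} {c} {d} a≈b c≈d =
    trans (%-distribˡ-* a c p) (trans (cong₂ (λ x y → (x * y) % p) a≈b c≈d) (sym (%-distribˡ-* b d p)))

  ^-congˡ : ∀ {a b} k → a ≈ b → a ^ k ≈ b ^ k
  ^-congˡ zero    a≈b = refl
  ^-congˡ (suc k) a≈b = *-cong a≈b (^-congˡ k a≈b)

  ∏-≈ : ∀ n {f g : ℕ → ℕ} → (∀ i → f i ≈ g i) → NaturalProduct.∏ n f ≈ NaturalProduct.∏ n g
  ∏-≈ zero    f≈g = refl
  ∏-≈ (suc n) f≈g = *-cong (f≈g 0) (∏-≈ n (λ i → f≈g (suc i)))

  0%p≡0 : 0 % p ≡ 0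
  0%p≡0 = Nat.n≤0⇒n≡0 (m%n≤m 0 p)

  p≈0 : p ≈ 0
  p≈0 = trans (n%n≡0 p) (sym 0%p≡0)

  ≈⇒≡ : ∀ {a b} → a < p → b < p → a ≈ b → a ≡ b
  ≈⇒≡ a<p b<p a≈b = trans (sym (m<n⇒m%n≡m a<p)) (trans a≈b (m<n⇒m%n≡m b<p))

  ≈0⇒∣ : ∀ {a} → a ≈ 0 → p ∣ a
  ≈0⇒∣ {a} a≈0 = m%n≡0⇒n∣m a p (trans a≈0 0%p≡0)

  ∣⇒≈0 : ∀ {a} → p ∣ a → a ≈ 0
  ∣⇒≈0 {a} p∣a = trans (n∣m⇒m%n≡0 a p p∣a) (sym 0%p≡0)

  neg : ℕ → ℕ
  neg c = p ∸ c % p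

  +-inverseʳ : ∀ c → c + neg c ≈ 0
  +-inverseʳ c = ≈-trans (+-cong (≈-sym (%-≈ c)) (≈-refl {neg c}))
                         (≈-trans (≈-reflexive (Nat.m+[n∸m]≡n (Nat.<⇒≤ (m%n<n c p)))) p≈0)

  ≈⇒∣∸ : ∀ {m n} → m ≤ n → m ≈ n → p ∣ n ∸ m
  ≈⇒∣∸ {m} {n} m≤n m≈n = divides (n / p ∸ m / p) (begin
    n ∸ m                                    ≡⟨ cong₂ _∸_ (m≡m%n+[m/n]*n n p) (m≡m%n+[m/n]*n m p) ⟩
    (n % p + n / p * p) ∸ (m % p + m / p * p) ≡⟨ cong (λ r → (r + n / p * p) ∸ (m % p + m / p * p)) (sym m≈n) ⟩
    (m % p + n / p * p) ∸ (m % p + m / p * p) ≡⟨ Nat.[m+n]∸[m+o]≡n∸o (m % p) _ _ ⟩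
    n / p * p ∸ m / p * p                    ≡⟨ sym (Nat.*-distribʳ-∸ p (n / p) (m / p)) ⟩
    (n / p ∸ m / p) * p                      ∎)
    where open ≡.≡-Reasoning

  ∣∸⇒≈ : ∀ {m n} → m ≤ n → p ∣ n ∸ m → m ≈ n
  ∣∸⇒≈ {m} {n} m≤n (divides q n∸m≡qp) = begin
    m % p                      ≡⟨ sym ([m+kn]%n≡m%n m q p) ⟩
    (m + q * p) % p            ≡⟨ cong (λ d → (m + d) % p) (sym n∸m≡qp) ⟩
    (m + (n ∸ m)) % p          ≡⟨ cong (_% p) (Nat.m+[n∸m]≡n m≤n) ⟩
    n % p                      ∎
    where open ≡.≡-Reasoning

  ∣⊖∣≡∸ : ∀ {m n} → m ≤ n → ∣ n ⊖ m ∣ ≡ n ∸ m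
  ∣⊖∣≡∸ m≤n = cong ∣_∣ (ℤ.⊖-≥ m≤n)

  ≈⇒∣- : ∀ {m n} → m ≈ n → + p ℤ.∣ + m ℤ.- + n
  ≈⇒∣- {m} {n} m≈n rewrite ℤ.m-n≡m⊖n m n with Nat.≤-total m n
  ... | inj₁ m≤n = ≡.subst (p ∣_) (sym (ℤ.∣⊖∣-≤ m≤n)) (≈⇒∣∸ m≤n m≈n)
  ... | inj₂ n≤m = ≡.subst (p ∣_) (sym (∣⊖∣≡∸ n≤m)) (≈⇒∣∸ n≤m (≈-sym m≈n))

  ∣-⇒≈ : ∀ {m n} → + p ℤ.∣ + m ℤ.- + n → m ≈ n
  ∣-⇒≈ {m} {n} p∣m-n rewrite ℤ.m-n≡m⊖n m n with Nat.≤-total m n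
  ... | inj₁ m≤n = ∣∸⇒≈ m≤n (≡.subst (p ∣_) (ℤ.∣⊖∣-≤ m≤n) p∣m-n)
  ... | inj₂ n≤m = ≈-sym (∣∸⇒≈ n≤m (≡.subst (p ∣_) (∣⊖∣≡∸ n≤m) p∣m-n))

module PrimeCongruence (p : ℕ) .{{_ : NonZero p}} (isPrime : Prime p) where
  open Congruence p
  open NaturalProduct
  open import Data.Nat.Base using (_+_; _*_; _^_; _%_; ≢-nonZero; >-nonZero; nonTrivial⇒n>1)
  import Data.Nat.Properties as Nat
  open import Data.Nat.DivMod using (m%n<n; m<n⇒m%n≡m; [m+kn]%n≡m%n)
  open import Data.Nat.Primality using (euclidsLemma; prime⇒nonTrivial)
  open import Data.Nat.Coprimality using (coprime-Bézout; prime⇒coprime)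
  open import Data.Nat.GCD using (module Bézout)
  open import Data.Nat.Solver using (module +-*-Solver)
  open +-*-Solver
  open import Data.Product using (∃; _,_; proj₁; proj₂)
  open import Data.Sum using (inj₁; inj₂)
  open import Relation.Nullary using (¬_)
  open ≡ using (refl; cong; sym; trans)
  import Relation.Binary.Reasoning.Setoid as SetoidReasoning

  1<p : 1 < p
  1<p = nonTrivial⇒n>1 p {{prime⇒nonTrivial isPrime}}

  1≉0 : ¬ 1 ≈ 0
  1≉0 1≈0 with trans (sym (m<n⇒m%n≡m 1<p)) (trans 1≈0 0%p≡0)
  ... | ()

  *-≉0 : ∀ {a b} → ¬ a ≈ 0 → ¬ b ≈ 0 → ¬ a * b ≈ 0
  *-≉0 {a} {b} a≉0 b≉0 ab≈0 with euclidsLemma a b isPrime (≈0⇒∣ ab≈0)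
  ... | inj₁ p∣a = a≉0 (∣⇒≈0 p∣a)
  ... | inj₂ p∣b = b≉0 (∣⇒≈0 p∣b)

  positive-≉0 : ∀ {x} → 0 < x → x < p → ¬ x ≈ 0
  positive-≉0 {x} 0<x x<p x≈0 = Nat.<⇒≢ 0<x (sym (trans (sym (m<n⇒m%n≡m x<p)) (trans x≈0 0%p≡0)))

  ≉0⇒inverse : ∀ a → ¬ a ≈ 0 → ∃ λ b → a * b ≈ 1
  ≉0⇒inverse a a≉0 = inverse-of-residue (≢-nonZero (λ a%p≡0 → a≉0 (trans a%p≡0 (sym 0%p≡0))))
    where
    open SetoidReasoning setoid
    n = a % p
    inverse-of-residue : NonZero n → ∃ λ b → a * b ≈ 1
    inverse-of-residue n≢0 with coprime-Bézout (prime⇒coprime isPrime {{n≢0}} (m%n<n a p))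
    ... | Bézout.-+ x y 1+xp≡yn = y , (begin
      a * y          ≈⟨ *-cong (≈-sym (%-≈ a)) (≈-refl {y}) ⟩
      n * y          ≡⟨ trans (Nat.*-comm n y) (sym 1+xp≡yn) ⟩
      1 + x * p      ≈⟨ [m+kn]%n≡m%n 1 x p ⟩
      1              ∎)
    ... | Bézout.+- x y 1+yn≡xp = (p ∸ 1) * y , (begin
      a * ((p ∸ 1) * y)               ≈⟨ *-cong (≈-sym (%-≈ a)) (≈-refl {(p ∸ 1) * y}) ⟩
      n * ((p ∸ 1) * y)               ≈⟨ ≈-sym ([m+kn]%n≡m%n _ x p) ⟩
      n * ((p ∸ 1) * y) + x * p       ≡⟨ cong (n * ((p ∸ 1) * y) +_) (sym 1+yn≡xp) ⟩
      n * ((p ∸ 1) * y) + (1 + y * n) ≡⟨ solve 3 (λ n q y → n :* (q :* y) :+ (con 1 :+ y :* n)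
                                                   := con 1 :+ (n :* y) :* (con 1 :+ q)) refl n (p ∸ 1) y ⟩
      1 + (n * y) * suc (p ∸ 1)       ≡⟨ cong (λ m → 1 + (n * y) * m) (Nat.suc-pred p) ⟩
      1 + (n * y) * p                 ≈⟨ [m+kn]%n≡m%n 1 (n * y) p ⟩
      1                               ∎)

  *-cancelʳ-≉0 : ∀ {a b c} → ¬ c ≈ 0 → a * c ≈ b * c → a ≈ b
  *-cancelʳ-≉0 {a} {b} {c} c≉0 ac≈bc = begin
    a                ≡⟨ sym (Nat.*-identityʳ a) ⟩
    a * 1            ≈⟨ *-cong (≈-refl {a}) (≈-sym cc⁻¹≈1) ⟩
    a * (c * c⁻¹)    ≡⟨ sym (Nat.*-assoc a c c⁻¹) ⟩
    a * c * c⁻¹      ≈⟨ *-cong ac≈bc (≈-refl {c⁻¹}) ⟩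
    b * c * c⁻¹      ≡⟨ Nat.*-assoc b c c⁻¹ ⟩
    b * (c * c⁻¹)    ≈⟨ *-cong (≈-refl {b}) cc⁻¹≈1 ⟩
    b * 1            ≡⟨ Nat.*-identityʳ b ⟩
    b                ∎
    where
    open SetoidReasoning setoid
    c⁻¹ = proj₁ (≉0⇒inverse c c≉0)
    cc⁻¹≈1 = proj₂ (≉0⇒inverse c c≉0)

  ∏-≉0 : ∀ n {f : ℕ → ℕ} → (∀ {i} → i < n → ¬ f i ≈ 0) → ¬ ∏ n f ≈ 0
  ∏-≉0 zero    f≉0 = 1≉0
  ∏-≉0 (suc n) f≉0 = *-≉0 (f≉0 (s≤s z≤n)) (∏-≉0 n (λ i<n → f≉0 (s≤s i<n)))

  unit-≉0 : ∀ {a b} → a * b ≈ 1 → ¬ a ≈ 0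
  unit-≉0 {a} {b} ab≈1 a≈0 = 1≉0 (≈-trans (≈-sym ab≈1) (*-cong a≈0 (≈-refl {b})))

  -- x ↦ a (x + 1) - 1 indexes the nonzero residues 1, …, p - 1 by 0, …, p - 2.
  dilate : ℕ → ℕ → ℕ
  dilate a x = (a * suc x) % p ∸ 1

  suc<p : ∀ {x} → x < p ∸ 1 → suc x < p
  suc<p {x} x<p-1 = ≡.subst (suc x <_) (Nat.suc-pred p) (s≤s x<p-1)

  dilate-nonzero : ∀ a {x} → ¬ a ≈ 0 → x < p ∸ 1 → 0 < (a * suc x) % p
  dilate-nonzero a {x} a≉0 x<p-1 = Nat.n≢0⇒n>0 (λ r≡0 →
    *-≉0 a≉0 (positive-≉0 (s≤s z≤n) (suc<p x<p-1)) (trans r≡0 (sym 0%p≡0)))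

  suc-dilate : ∀ a {x} → ¬ a ≈ 0 → x < p ∸ 1 → suc (dilate a x) ≡ (a * suc x) % p
  suc-dilate a a≉0 x<p-1 = Nat.suc-pred _ {{>-nonZero (dilate-nonzero a a≉0 x<p-1)}}

  dilate-< : ∀ a {x} → ¬ a ≈ 0 → x < p ∸ 1 → dilate a x < p ∸ 1
  dilate-< a a≉0 x<p-1 = Nat.∸-monoˡ-< (m%n<n _ p) (dilate-nonzero a a≉0 x<p-1)

  dilate-inverse : ∀ a b → a * b ≈ 1 → ∀ {x} → x < p ∸ 1 → dilate b (dilate a x) ≡ x
  dilate-inverse a b ab≈1 {x} x<p-1 = cong (_∸ 1) (≈⇒≡ (m%n<n _ p) (suc<p x<p-1) (begin
    b * suc (dilate a x) % p ≈⟨ %-≈ _ ⟩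
    b * suc (dilate a x)    ≡⟨ cong (b *_) (suc-dilate a (unit-≉0 ab≈1) x<p-1) ⟩
    b * ((a * suc x) % p)   ≈⟨ *-cong (≈-refl {b}) (%-≈ (a * suc x)) ⟩
    b * (a * suc x)         ≡⟨ solve 3 (λ a b s → b :* (a :* s) := (a :* b) :* s) refl a b (suc x) ⟩
    (a * b) * suc x         ≈⟨ *-cong ab≈1 (≈-refl {suc x}) ⟩
    1 * suc x               ≡⟨ Nat.*-identityˡ (suc x) ⟩
    suc x                   ∎))
    where open SetoidReasoning setoid

  dilate-permutes : ∀ a b → a * b ≈ 1 → InverseBelow (p ∸ 1) (dilate a) (dilate b)
  dilate-permutes a b ab≈1 = record
    { σ-< = dilate-< a (unit-≉0 ab≈1)
    ; τ-< = dilate-< b (unit-≉0 ba≈1)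
    ; τ∘σ = dilate-inverse a b ab≈1
    ; σ∘τ = dilate-inverse b a ba≈1
    }
    where ba≈1 = ≈-trans (≈-reflexive (Nat.*-comm b a)) ab≈1

  -- Multiplying the nonzero residues by a permutes them, so a^(p-1) (p-1)! ≡ (p-1)!.
  fermat : ∀ a → ¬ a ≈ 0 → a ^ (p ∸ 1) ≈ 1
  fermat a a≉0 = *-cancelʳ-≉0 (∏-≉0 (p ∸ 1) (λ x<p-1 → positive-≉0 (s≤s z≤n) (suc<p x<p-1))) (begin
    a ^ (p ∸ 1) * ∏ (p ∸ 1) suc           ≡⟨ sym (∏-scale (p ∸ 1) a suc) ⟩
    ∏ (p ∸ 1) (λ x → a * suc x)           ≈⟨ ∏-≈ (p ∸ 1) (λ x → ≈-sym (%-≈ (a * suc x))) ⟩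
    ∏ (p ∸ 1) (λ x → (a * suc x) % p)     ≡⟨ sym (∏-cong (p ∸ 1) (suc-dilate a a≉0)) ⟩
    ∏ (p ∸ 1) (λ x → suc (dilate a x))    ≡⟨ ∏-permute (p ∸ 1) suc (dilate-permutes a a⁻¹ aa⁻¹≈1) ⟩
    ∏ (p ∸ 1) suc                         ≡⟨ sym (Nat.*-identityˡ _) ⟩
    1 * ∏ (p ∸ 1) suc                     ∎)
    where
    open SetoidReasoning setoid
    a⁻¹ = proj₁ (≉0⇒inverse a a≉0)
    aa⁻¹≈1 = proj₂ (≉0⇒inverse a a≉0)

module MonicPolynomial where
  open import Data.Integer hiding (suc; _<_)
  open import Data.Integer.Properties using (*-identityˡ; +-identityˡ; *-assoc)
  open import Data.Integer.Solver using (module +-*-Solver)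
  open +-*-Solver
  open import Data.List using (List; []; _∷_; length; replicate; _++_)
  open import Data.List.Properties using (length-++; length-replicate)
  import Data.Nat.Base as ℕ
  import Data.Nat.Properties as ℕ
  open ≡ using (refl; cong; cong₂; sym; trans)

  -- [c₀, …, cₙ₋₁] stands for the monic polynomial c₀ + c₁ x + … + cₙ₋₁ xⁿ⁻¹ + xⁿ.
  evalMonic : List ℤ → ℤ → ℤ
  evalMonic []       x = 1ℤ
  evalMonic (c ∷ cs) x = c + x * evalMonic cs x

  quotient : ℤ → List ℤ → List ℤ
  quotient a []            = []
  quotient a (c ∷ [])      = []
  quotient a (c ∷ c′ ∷ cs) = evalMonic (c′ ∷ cs) a ∷ quotient a (c′ ∷ cs)

  length-quotient : ∀ a c cs → length (quotient a (c ∷ cs)) ≡ length cs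
  length-quotient a c []        = refl
  length-quotient a c (c′ ∷ cs) = cong suc (length-quotient a c′ cs)

  factor-theorem : ∀ a c cs x →
    evalMonic (c ∷ cs) x - evalMonic (c ∷ cs) a ≡ (x - a) * evalMonic (quotient a (c ∷ cs)) x
  factor-theorem a c []        x =
    solve 3 (λ c x a → (c :+ x :* con 1ℤ) :- (c :+ a :* con 1ℤ) := (x :- a) :* con 1ℤ) refl c x a
  factor-theorem a c (c′ ∷ cs) x = begin
    (c + x * F x) - (c + a * F a)       ≡⟨ solve 5 (λ c x a Fx Fa → (c :+ x :* Fx) :- (c :+ a :* Fa)
                                                 := (x :- a) :* Fa :+ x :* (Fx :- Fa)) refl c x a (F x) (F a) ⟩
    (x - a) * F a + x * (F x - F a)     ≡⟨ cong (λ d → (x - a) * F a + x * d) (factor-theorem a c′ cs x) ⟩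
    (x - a) * F a + x * ((x - a) * Q)   ≡⟨ solve 4 (λ x a Fa Q → (x :- a) :* Fa :+ x :* ((x :- a) :* Q)
                                                 := (x :- a) :* (Fa :+ x :* Q)) refl x a (F a) Q ⟩
    (x - a) * (F a + x * Q)             ∎
    where
    open ≡.≡-Reasoning
    F = evalMonic (c′ ∷ cs)
    Q = evalMonic (quotient a (c′ ∷ cs)) x

  geometricMonic : ℤ → ℕ → List ℤ
  geometricMonic r zero    = []
  geometricMonic r (suc m) = r ^ suc m ∷ geometricMonic r m

  length-geometricMonic : ∀ r m → length (geometricMonic r m) ≡ m
  length-geometricMonic r zero    = refl
  length-geometricMonic r (suc m) = cong suc (length-geometricMonic r m)

  geometricMonic-telescopes : ∀ r m y → (y - r) * evalMonic (geometricMonic r m) y ≡ y ^ suc m - r ^ suc m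
  geometricMonic-telescopes r zero    y = solve 2 (λ y r → (y :- r) :* con 1ℤ := y :* con 1ℤ :- r :* con 1ℤ) refl y r
  geometricMonic-telescopes r (suc m) y = begin
    (y - r) * (R + y * G)
      ≡⟨ solve 4 (λ y r R G → (y :- r) :* (R :+ y :* G) := R :* (y :- r) :+ y :* ((y :- r) :* G)) refl y r R G ⟩
    R * (y - r) + y * ((y - r) * G)
      ≡⟨ cong (λ d → R * (y - r) + y * d) (geometricMonic-telescopes r m y) ⟩
    R * (y - r) + y * (Y - R)
      ≡⟨ solve 4 (λ y r R Y → R :* (y :- r) :+ y :* (Y :- R) := y :* Y :- r :* R) refl y r R Y ⟩
    y * Y - r * R
      ∎
    where
    open ≡.≡-Reasoning
    G = evalMonic (geometricMonic r m) y
    R = r ^ suc m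
    Y = y ^ suc m

  precomposePower : ℕ → List ℤ → List ℤ
  precomposePower k []       = []
  precomposePower k (c ∷ cs) = c ∷ (replicate k 0ℤ ++ precomposePower k cs)

  length-precomposePower : ∀ k cs → length (precomposePower k cs) ≡ suc k ℕ.* length cs
  length-precomposePower k []       = sym (ℕ.*-zeroʳ (suc k))
  length-precomposePower k (c ∷ cs) = trans
    (cong suc (trans (length-++ (replicate k 0ℤ)) (cong₂ ℕ._+_ (length-replicate k) (length-precomposePower k cs))))
    (sym (ℕ.*-suc (suc k) (length cs)))

  evalMonic-zeros : ∀ m cs x → evalMonic (replicate m 0ℤ ++ cs) x ≡ x ^ m * evalMonic cs x
  evalMonic-zeros zero    cs x = sym (*-identityˡ _)
  evalMonic-zeros (suc m) cs x = trans (+-identityˡ _) (trans (cong (x *_) (evalMonic-zeros m cs x)) (sym (*-assoc x _ _)))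

  evalMonic-precomposePower : ∀ k cs x → evalMonic (precomposePower k cs) x ≡ evalMonic cs (x ^ suc k)
  evalMonic-precomposePower k []       x = refl
  evalMonic-precomposePower k (c ∷ cs) x = cong (_+_ c) (begin
    x * evalMonic (replicate k 0ℤ ++ precomposePower k cs) x   ≡⟨ cong (x *_) (evalMonic-zeros k _ x) ⟩
    x * (x ^ k * evalMonic (precomposePower k cs) x)          ≡⟨ sym (*-assoc x _ _) ⟩
    x ^ suc k * evalMonic (precomposePower k cs) x            ≡⟨ cong (x ^ suc k *_) (evalMonic-precomposePower k cs x) ⟩
    x ^ suc k * evalMonic cs (x ^ suc k)                      ∎)
    where open ≡.≡-Reasoning

module RootCount (p : ℕ) .{{_ : NonZero p}} (isPrime : Prime p) where
  open Congruence p
  open PrimeCongruence p isPrime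
  open MonicPolynomial
  open IntegerSum
  open import Data.Integer.Base using (ℤ; +_; _+_; _-_; _*_; _≤_; ∣_∣; 1ℤ; +≤+)
  import Data.Integer.Properties as ℤ
  open import Data.Integer.Divisibility using () renaming (_∣_ to _∣ℤ_)
  import Data.Integer.Divisibility.Signed as Signed
  import Data.Nat.Base as Nat
  import Data.Nat.Properties as Nat
  open import Data.Nat.Divisibility using (_∣?_; ∣⇒≤)
  open import Data.Nat.Primality using (euclidsLemma)
  open import Data.List using (List; []; _∷_; length)
  open import Data.Product using (_,_)
  open import Data.Sum as Sum using (_⊎_)
  open import Relation.Nullary using (Dec; yes; no)
  open ≡ using (trans; subst)

  ∣m∣n⇒∣m-n : ∀ u v → + p ∣ℤ u → + p ∣ℤ v → + p ∣ℤ u - v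
  ∣m∣n⇒∣m-n u v p∣u p∣v =
    Signed.∣⇒∣ᵤ {+ p} {u - v}
      (Signed.∣m∣n⇒∣m-n (Signed.∣ᵤ⇒∣ {+ p} {u} p∣u) (Signed.∣ᵤ⇒∣ {+ p} {v} p∣v))

  ∣m*n⇒∣m⊎∣n : ∀ u v → + p ∣ℤ u * v → (+ p ∣ℤ u) ⊎ (+ p ∣ℤ v)
  ∣m*n⇒∣m⊎∣n u v p∣uv = euclidsLemma ∣ u ∣ ∣ v ∣ isPrime (subst (p ∣_) (ℤ.abs-* u v) p∣uv)

  IsRoot : List ℤ → ℕ → Set
  IsRoot cs x = + p ∣ℤ evalMonic cs (+ x)

  root? : ∀ cs x → Dec (IsRoot cs x)
  root? cs x = p ∣? ∣ evalMonic cs (+ x) ∣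

  roots : List ℤ → ℤ
  roots cs = ∑ p (λ x → 𝟙 (root? cs x))

  root-of-factor : ∀ {a} c cs → IsRoot (c ∷ cs) a → ∀ {x} → x Nat.< p → a Nat.< p →
                   IsRoot (c ∷ cs) x → x ≡ a ⊎ IsRoot (quotient (+ a) (c ∷ cs)) x
  root-of-factor {a} c cs f[a]≡0 {x} x<p a<p f[x]≡0 =
    Sum.map₁ (λ p∣x-a → ≈⇒≡ x<p a<p (∣-⇒≈ p∣x-a)) (∣m*n⇒∣m⊎∣n (+ x - + a) _ p∣[x-a]q[x])
    where
    f = evalMonic (c ∷ cs)
    p∣[x-a]q[x] : + p ∣ℤ (+ x - + a) * evalMonic (quotient (+ a) (c ∷ cs)) (+ x)
    p∣[x-a]q[x] = subst (+ p ∣ℤ_) (factor-theorem (+ a) c cs (+ x))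
                        (∣m∣n⇒∣m-n (f (+ x)) (f (+ a)) f[x]≡0 f[a]≡0)

  roots≤degree : ∀ n cs → length cs ≡ n → roots cs ≤ + n
  roots≤degree zero    []       _ =
    ℤ.≤-reflexive (∑-zero p (λ {x} _ → 𝟙-no (root? [] x) (λ p∣1 → Nat.<⇒≱ 1<p (∣⇒≤ p∣1))))
  roots≤degree (suc n) (c ∷ cs) deg with Nat.anyUpTo? (root? (c ∷ cs)) p
  ... | no no-root = ℤ.≤-trans (ℤ.≤-reflexive (∑-zero p (λ {x} x<p → 𝟙-no (root? (c ∷ cs) x)
                                  (λ f[x]≡0 → no-root (x , x<p , f[x]≡0))))) (+≤+ z≤n)
  ... | yes (a , a<p , f[a]≡0) = begin
    roots (c ∷ cs)
      ≤⟨ ∑-mono-≤ p (λ {x} x<p → 𝟙-⊎ (root? (c ∷ cs) x) (x Nat.≟ a) (root? q x) (root-of-factor c cs f[a]≡0 x<p a<p)) ⟩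
    ∑ p (λ x → 𝟙 (x Nat.≟ a) + 𝟙 (root? q x))
      ≡⟨ ∑-distrib-+ p (λ x → 𝟙 (x Nat.≟ a)) (λ x → 𝟙 (root? q x)) ⟩
    ∑ p (λ x → 𝟙 (x Nat.≟ a)) + roots q
      ≤⟨ ℤ.+-mono-≤ (∑-𝟙-≡-≤1 p a) (roots≤degree n q deg-q) ⟩
    1ℤ + + n
      ∎
    where
    open ℤ.≤-Reasoning
    q = quotient (+ a) (c ∷ cs)
    deg-q : length q ≡ n
    deg-q = trans (length-quotient (+ a) c cs) (Nat.suc-injective deg)

module PowerResidue (p : ℕ) .{{_ : NonZero p}} (isPrime : Prime p)
                    (ℓ : ℕ) .{{_ : NonZero ℓ}} (ℓ∣p-1 : ℓ ∣ p ∸ 1) where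
  open Congruence p
  open PrimeCongruence p isPrime
  open RootCount p isPrime
  open MonicPolynomial
  open IntegerSum
  open PowerLaws
  open import Data.Nat.Base using (_+_; _*_; _^_; _/_; ≢-nonZero)
  import Data.Nat.Properties as Nat
  open import Data.Nat.DivMod using (m/n*n≡m; m<n⇒m%n≡m)
  open import Data.Integer.Divisibility using () renaming (_∣_ to _∣ℤ_)
  open import Data.Integer.Base as ℤ using (+_; 1ℤ)
    renaming (_+_ to _+ℤ_; _-_ to _-ℤ_; _*_ to _*ℤ_; _≤_ to _≤ℤ_)
  import Data.Integer.Properties as ℤ
  open import Data.List using (List; length)
  open import Data.Sum as Sum using (_⊎_; inj₁; inj₂)
  open import Data.Unit using (tt)
  open import Relation.Nullary using (yes; no; ¬_)
  open import Relation.Nullary.Decidable using (_⊎-dec_)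
  open ≡ using (refl; cong; cong₂; sym; trans; subst)
  open import Function using (id)
  open import Data.Integer.Solver using (module +-*-Solver)

  k : ℕ
  k = (p ∸ 1) / ℓ

  k*ℓ≡p-1 : k * ℓ ≡ p ∸ 1
  k*ℓ≡p-1 = m/n*n≡m ℓ∣p-1

  k≢0 : ¬ k ≡ 0
  k≢0 k≡0 = Nat.<⇒≱ 1<p (Nat.m∸n≡0⇒m≤n (trans (sym k*ℓ≡p-1) (cong (_* ℓ) k≡0)))

  k≡suc[k-1] : k ≡ suc (k ∸ 1)
  k≡suc[k-1] = sym (Nat.suc-pred k {{≢-nonZero k≢0}})

  ℓ≡suc[ℓ-1] : ℓ ≡ suc (ℓ ∸ 1)
  ℓ≡suc[ℓ-1] = sym (Nat.suc-pred ℓ)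

  χ : ℕ → ℕ
  χ = powerResidue p ℓ

  χ-cong : ∀ {x y} → x ≈ y → χ x ≡ χ y
  χ-cong = ^-congˡ k

  χ-kernel-* : ∀ {b} y → χ b ≡ 1 → χ (b * y) ≡ χ y
  χ-kernel-* {b} y χb≡1 = ≈-trans (≈-reflexive (^-distribʳ-* b y k))
    (≈-trans (*-cong (trans χb≡1 (sym (m<n⇒m%n≡m 1<p))) (≈-refl {y ^ k})) (≈-reflexive (Nat.*-identityˡ (y ^ k))))

  χ-kernel-≉0 : ∀ {b} → χ b ≡ 1 → ¬ b ≈ 0
  χ-kernel-≉0 {b} χb≡1 b≈0 = 1≉0 (≈-trans (trans (m<n⇒m%n≡m 1<p) (sym χb≡1))
    (≈-trans (^-congˡ k b≈0) (≈-reflexive (cong (0 ^_) k≡suc[k-1]))))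

  fibre : ℕ → ℤ
  fibre t = ∑ p (λ x → 𝟙 (χ x Nat.≟ t))

  fibre≥0 : ∀ t → 0ℤ ≤ℤ fibre t
  fibre≥0 t = ∑-nonNeg p (λ {x} _ → 𝟙≥0 (χ x Nat.≟ t))

  -- The polynomial (X^(p-1) - t^ℓ) / (X^k - t), of degree k (ℓ - 1).
  cofactor : ℕ → List ℤ
  cofactor t = precomposePower (k ∸ 1) (geometricMonic (+ t) (ℓ ∸ 1))

  degree-cofactor : ∀ t → length (cofactor t) ≡ k * (ℓ ∸ 1)
  degree-cofactor t = trans (length-precomposePower (k ∸ 1) (geometricMonic (+ t) (ℓ ∸ 1)))
    (cong₂ _*_ (sym k≡suc[k-1]) (length-geometricMonic (+ t) (ℓ ∸ 1)))

  χ-or-cofactor-root : ∀ {t} → t < p → t ^ ℓ ≈ 1 → ∀ {x} → x < p → ¬ x ≡ 0 →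
                       χ x ≡ t ⊎ IsRoot (cofactor t) x
  χ-or-cofactor-root {t} t<p tˡ≈1 {x} x<p x≢0 =
    Sum.map (λ p∣y-t → trans (∣-⇒≈ p∣y-t) (m<n⇒m%n≡m t<p)) (subst (+ p ∣ℤ_) (sym cofactor-at-x))
            (∣m*n⇒∣m⊎∣n (y -ℤ + t) G p∣[y-t]G)
    where
    y = + (x ^ k)
    G = evalMonic (geometricMonic (+ t) (ℓ ∸ 1)) y
    xᵏˡ≈1 : (x ^ k) ^ ℓ ≈ 1
    xᵏˡ≈1 = ≈-trans (≈-reflexive (trans (Nat.^-*-assoc x k ℓ) (cong (x ^_) k*ℓ≡p-1)))
                    (fermat x (positive-≉0 (Nat.n≢0⇒n>0 x≢0) x<p))
    [y-t]G≡yˡ-tˡ : (y -ℤ + t) *ℤ G ≡ + ((x ^ k) ^ ℓ) -ℤ + (t ^ ℓ)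
    [y-t]G≡yˡ-tˡ = begin
      (y -ℤ + t) *ℤ G                            ≡⟨ geometricMonic-telescopes (+ t) (ℓ ∸ 1) y ⟩
      y ℤ.^ suc (ℓ ∸ 1) -ℤ (+ t) ℤ.^ suc (ℓ ∸ 1)
                                                 ≡⟨ cong (λ n → y ℤ.^ n -ℤ (+ t) ℤ.^ n) (sym ℓ≡suc[ℓ-1]) ⟩
      y ℤ.^ ℓ -ℤ (+ t) ℤ.^ ℓ                     ≡⟨ cong₂ _-ℤ_ (sym (pos-^ (x ^ k) ℓ)) (sym (pos-^ t ℓ)) ⟩
      + ((x ^ k) ^ ℓ) -ℤ + (t ^ ℓ)               ∎
      where open ≡.≡-Reasoning
    p∣[y-t]G : + p ∣ℤ (y -ℤ + t) *ℤ G
    p∣[y-t]G = subst (+ p ∣ℤ_) (sym [y-t]G≡yˡ-tˡ) (≈⇒∣- (≈-trans xᵏˡ≈1 (≈-sym tˡ≈1)))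
    cofactor-at-x : evalMonic (cofactor t) (+ x) ≡ G
    cofactor-at-x = trans (evalMonic-precomposePower (k ∸ 1) (geometricMonic (+ t) (ℓ ∸ 1)) (+ x))
      (cong (evalMonic (geometricMonic (+ t) (ℓ ∸ 1))) (trans (cong ((+ x) ℤ.^_) (sym k≡suc[k-1])) (sym (pos-^ x k))))

  p≡1+k[ℓ-1]+k : p ≡ 1 + (k * (ℓ ∸ 1) + k)
  p≡1+k[ℓ-1]+k = begin
    p                           ≡⟨ sym (Nat.suc-pred p) ⟩
    suc (p ∸ 1)                 ≡⟨ cong suc (sym k*ℓ≡p-1) ⟩
    suc (k * ℓ)                 ≡⟨ cong (λ n → suc (k * n)) ℓ≡suc[ℓ-1] ⟩
    suc (k * suc (ℓ ∸ 1))       ≡⟨ cong suc (trans (Nat.*-suc k (ℓ ∸ 1)) (Nat.+-comm k _)) ⟩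
    1 + (k * (ℓ ∸ 1) + k)       ∎
    where open ≡.≡-Reasoning

  -- Each x ∈ [0, p) is 0, lies in the fibre of t, or is one of the at most k (ℓ - 1) roots of the cofactor.
  fibre-lower : ∀ {t} → t < p → t ^ ℓ ≈ 1 → + k ≤ℤ fibre t
  fibre-lower {t} t<p tˡ≈1 = +-cancelˡ-≤ (1ℤ +ℤ + (k * (ℓ ∸ 1))) (begin
    1ℤ +ℤ + (k * (ℓ ∸ 1)) +ℤ + k
      ≡⟨ sym p-as-sum ⟩
    ∑ p (λ _ → 1ℤ)
      ≤⟨ ∑-mono-≤ p covered ⟩
    ∑ p (λ x → [≡0] x +ℤ ([χ≡t] x +ℤ [root] x))
      ≡⟨ trans (∑-distrib-+ p [≡0] (λ x → [χ≡t] x +ℤ [root] x)) (cong (∑ p [≡0] +ℤ_) (∑-distrib-+ p [χ≡t] [root])) ⟩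
    ∑ p [≡0] +ℤ (fibre t +ℤ roots (cofactor t))
      ≤⟨ ℤ.+-mono-≤ (∑-𝟙-≡-≤1 p 0) (ℤ.+-monoʳ-≤ (fibre t) (roots≤degree _ (cofactor t) (degree-cofactor t))) ⟩
    1ℤ +ℤ (fibre t +ℤ + (k * (ℓ ∸ 1)))
      ≡⟨ solve 3 (λ a b c → a :+ (b :+ c) := (a :+ c) :+ b) refl 1ℤ (fibre t) _ ⟩
    1ℤ +ℤ + (k * (ℓ ∸ 1)) +ℤ fibre t
      ∎)
    where
    open ℤ.≤-Reasoning
    open +-*-Solver using (solve; _:+_; _:=_)
    [≡0] [χ≡t] [root] : ℕ → ℤ
    [≡0] x = 𝟙 (x Nat.≟ 0)
    [χ≡t] x = 𝟙 (χ x Nat.≟ t)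
    [root] x = 𝟙 (root? (cofactor t) x)
    p-as-sum : ∑ p (λ _ → 1ℤ) ≡ 1ℤ +ℤ + (k * (ℓ ∸ 1)) +ℤ + k
    p-as-sum = trans (∑-const p 1ℤ) (trans (ℤ.*-identityʳ (+ p)) (cong +_ p≡1+k[ℓ-1]+k))
    covered : ∀ {x} → x < p → 1ℤ ≤ℤ [≡0] x +ℤ ([χ≡t] x +ℤ [root] x)
    covered {x} x<p = ℤ.≤-trans (𝟙-⊎ (yes tt) (x Nat.≟ 0) fibre-or-root? (λ _ → zero-or-not))
                                (ℤ.+-monoʳ-≤ ([≡0] x) (𝟙-⊎ fibre-or-root? (χ x Nat.≟ t) (root? (cofactor t) x) id))
      where
      fibre-or-root? = χ x Nat.≟ t ⊎-dec root? (cofactor t) x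
      zero-or-not : x ≡ 0 ⊎ (χ x ≡ t ⊎ IsRoot (cofactor t) x)
      zero-or-not with x Nat.≟ 0
      ... | yes x≡0 = inj₁ x≡0
      ... | no x≢0  = inj₂ (χ-or-cofactor-root t<p tˡ≈1 x<p x≢0)

module AffineSubstitution (p : ℕ) .{{_ : NonZero p}} (isPrime : Prime p) where
  open Congruence p
  open PrimeCongruence p isPrime
  open IntegerSum using (∑; ∑-permute)
  open import Data.Nat.Base using (_+_; _*_; _%_)
  import Data.Nat.Properties as Nat
  open import Data.Nat.DivMod using (m%n<n)
  open import Data.Nat.Solver using (module +-*-Solver)
  open +-*-Solver
  open import Data.Product using (proj₂)
  open import Relation.Nullary using (¬_)
  open ≡ using (trans)
  import Relation.Binary.Reasoning.Setoid as SetoidReasoning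

  affine-permutes : ∀ c d {e} → d * e ≈ 1 → InverseBelow p (λ x → (c + d * x) % p) (λ y → (e * (y + neg c)) % p)
  affine-permutes c d {e} de≈1 = record
    { σ-< = λ _ → m%n<n _ p
    ; τ-< = λ _ → m%n<n _ p
    ; τ∘σ = λ {x} x<p → ≈⇒≡ (m%n<n _ p) x<p (begin
        (e * ((c + d * x) % p + neg c)) % p   ≈⟨ %-≈ _ ⟩
        e * ((c + d * x) % p + neg c)         ≈⟨ *-cong (≈-refl {e}) (+-cong (%-≈ (c + d * x)) (≈-refl {neg c})) ⟩
        e * ((c + d * x) + neg c)             ≡⟨ solve 5 (λ e c d x c′ → e :* ((c :+ d :* x) :+ c′) := (d :* e) :* x :+ e :* (c :+ c′))
                                                   ≡.refl e c d x (neg c) ⟩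
        (d * e) * x + e * (c + neg c)         ≈⟨ +-cong (*-cong de≈1 (≈-refl {x})) (*-cong (≈-refl {e}) (+-inverseʳ c)) ⟩
        1 * x + e * 0                         ≡⟨ solve 2 (λ x e → con 1 :* x :+ e :* con 0 := x) ≡.refl x e ⟩
        x                                     ∎)
    ; σ∘τ = λ {y} y<p → ≈⇒≡ (m%n<n _ p) y<p (begin
        (c + d * ((e * (y + neg c)) % p)) % p ≈⟨ %-≈ _ ⟩
        c + d * ((e * (y + neg c)) % p)       ≈⟨ +-cong (≈-refl {c}) (*-cong (≈-refl {d}) (%-≈ (e * (y + neg c)))) ⟩
        c + d * (e * (y + neg c))             ≡⟨ solve 5 (λ e c d y c′ → c :+ d :* (e :* (y :+ c′)) := (d :* e) :* (y :+ c′) :+ c)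
                                                   ≡.refl e c d y (neg c) ⟩
        (d * e) * (y + neg c) + c             ≈⟨ +-cong (*-cong de≈1 (≈-refl {y + neg c})) (≈-refl {c}) ⟩
        1 * (y + neg c) + c                   ≡⟨ solve 3 (λ y c′ c → con 1 :* (y :+ c′) :+ c := y :+ (c :+ c′)) ≡.refl y (neg c) c ⟩
        y + (c + neg c)                       ≈⟨ +-cong (≈-refl {y}) (+-inverseʳ c) ⟩
        y + 0                                 ≡⟨ Nat.+-identityʳ y ⟩
        y                                     ∎)
    }
    where open SetoidReasoning setoid

  ∑-affine : ∀ c {d} → ¬ d ≈ 0 → (F : ℕ → ℤ) → (∀ {x y} → x ≈ y → F x ≡ F y) →
             ∑ p (λ x → F (c + d * x)) ≡ ∑ p F
  ∑-affine c {d} d≉0 F F-cong = trans (IntegerSum.∑-cong p (λ {x} _ → F-cong (≈-sym (%-≈ (c + d * x)))))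
    (∑-permute p F (affine-permutes c d (proj₂ (≉0⇒inverse d d≉0))))

module ProgressionSums (p : ℕ) .{{_ : NonZero p}} (isPrime : Prime p) (G : ℕ → ℤ)
                       (G-cong : ∀ {x y} → Congruence._≈_ p x y → G x ≡ G y)
                       (∑G≡0 : IntegerSum.∑ p G ≡ 0ℤ) where
  open Congruence p
  open PrimeCongruence p isPrime
  open AffineSubstitution p isPrime
  open IntegerSum
  open import Data.Nat.Base using (_+_; _*_; _≤_)
  import Data.Nat.Properties as Nat
  open import Data.Integer.Base using (+_; 1ℤ; nonNegative)
    renaming (_*_ to _*ℤ_; _≤_ to _≤ℤ_)
  import Data.Integer.Properties as ℤ
  open import Relation.Binary.Definitions using (tri<; tri≈; tri>)
  open import Relation.Nullary using (¬_; Dec; yes; no)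
  open import Relation.Unary using (Decidable)
  open ≡ using (refl; cong; cong₂; sym; trans)
  open import Data.Nat.Solver using (module +-*-Solver)
  open +-*-Solver

  progressionSum : ℕ → ℕ → ℕ → ℤ
  progressionSum L a b = ∑ L (λ i → G (a + b * i))

  energy : ℤ
  energy = ∑ p (λ x → G x *ℤ G x)

  energy≥0 : 0ℤ ≤ℤ energy
  energy≥0 = ∑-nonNeg p (λ {x} _ → i*i≥0 (G x))

  correlation : ℕ → ℤ
  correlation δ = ∑ p (λ b → ∑ p (λ a → G a *ℤ G (a + b * δ)))

  correlation-zero : correlation 0 ≡ + p *ℤ energy
  correlation-zero = trans (∑-cong p (λ {b} _ → ∑-cong p (λ {a} _ → cong (λ z → G a *ℤ G z) (a+b*0≡a a b))))
                           (∑-const p energy)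
    where
    a+b*0≡a : ∀ a b → a + b * 0 ≡ a
    a+b*0≡a a b = trans (cong (_+_ a) (Nat.*-zeroʳ b)) (Nat.+-identityʳ a)

  -- Summing over all steps b first makes a + b δ run over all residues, where G has mean zero.
  correlation-nonzero : ∀ {δ} → 0 < δ → δ < p → correlation δ ≡ 0ℤ
  correlation-nonzero {δ} 0<δ δ<p = begin
    ∑ p (λ b → ∑ p (λ a → G a *ℤ G (a + b * δ)))
      ≡⟨ ∑-comm p p (λ b a → G a *ℤ G (a + b * δ)) ⟩
    ∑ p (λ a → ∑ p (λ b → G a *ℤ G (a + b * δ)))
      ≡⟨ ∑-cong p (λ {a} _ → ∑-distribˡ-* p (G a) (λ b → G (a + b * δ))) ⟩
    ∑ p (λ a → G a *ℤ ∑ p (λ b → G (a + b * δ)))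
      ≡⟨ ∑-cong p (λ {a} _ → cong (G a *ℤ_) (shifted-mean a)) ⟩
    ∑ p (λ a → G a *ℤ 0ℤ)
      ≡⟨ ∑-zero p (λ {a} _ → ℤ.*-zeroʳ (G a)) ⟩
    0ℤ
      ∎
    where
    open ≡.≡-Reasoning
    shifted-mean : ∀ a → ∑ p (λ b → G (a + b * δ)) ≡ 0ℤ
    shifted-mean a = trans (∑-cong p (λ {b} _ → cong (λ z → G (a + z)) (Nat.*-comm b δ)))
                           (trans (∑-affine a (positive-≉0 0<δ δ<p) G G-cong) ∑G≡0)

  pairCorrelation : ℕ → ℕ → ℤ
  pairCorrelation i j = ∑ p (λ b → ∑ p (λ a → G (a + b * i) *ℤ G (a + b * j)))

  pairCorrelation-comm : ∀ i j → pairCorrelation i j ≡ pairCorrelation j i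
  pairCorrelation-comm i j = ∑-cong p (λ {b} _ → ∑-cong p (λ {a} _ → ℤ.*-comm (G (a + b * i)) (G (a + b * j))))

  pairCorrelation-shift : ∀ i δ → pairCorrelation i (i + δ) ≡ correlation δ
  pairCorrelation-shift i δ = ∑-cong p (λ {b} _ → trans
      (∑-cong p (λ {a} _ → cong₂ (λ x y → G x *ℤ G y)
        (solve 3 (λ a b i → a :+ b :* i := b :* i :+ con 1 :* a) refl a b i)
        (solve 4 (λ a b i δ → a :+ b :* (i :+ δ) := (b :* i :+ con 1 :* a) :+ b :* δ) refl a b i δ)))
      (∑-affine (b * i) (positive-≉0 (s≤s z≤n) 1<p) (λ y → G y *ℤ G (y + b * δ))
        (λ x≈y → cong₂ _*ℤ_ (G-cong x≈y) (G-cong (+-cong x≈y ≈-refl)))))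

  pairCorrelation-diagonal : ∀ i → pairCorrelation i i ≡ + p *ℤ energy
  pairCorrelation-diagonal i = trans (cong (pairCorrelation i) (sym (Nat.+-identityʳ i)))
                                     (trans (pairCorrelation-shift i 0) correlation-zero)

  pairCorrelation-off-diagonal : ∀ {i j} → i < j → j < p → pairCorrelation i j ≡ 0ℤ
  pairCorrelation-off-diagonal {i} {j} i<j j<p = begin
    pairCorrelation i j                ≡⟨ cong (pairCorrelation i) (sym (Nat.m+[n∸m]≡n (Nat.<⇒≤ i<j))) ⟩
    pairCorrelation i (i + (j ∸ i))    ≡⟨ pairCorrelation-shift i (j ∸ i) ⟩
    correlation (j ∸ i)                ≡⟨ correlation-nonzero (Nat.m<n⇒0<n∸m i<j) (Nat.≤-<-trans (Nat.m∸n≤m j i) j<p) ⟩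
    0ℤ                                 ∎
    where open ≡.≡-Reasoning

  pairCorrelation-orthogonal : ∀ {L i j} → L ≤ p → i < L → j < L →
                               pairCorrelation i j ≡ 𝟙 (j Nat.≟ i) *ℤ (+ p *ℤ energy)
  pairCorrelation-orthogonal {L} {i} {j} L≤p i<L j<L with Nat.<-cmp i j
  ... | tri< i<j _ _ = trans (pairCorrelation-off-diagonal i<j (Nat.<-≤-trans j<L L≤p))
                             (sym (trans (cong (_*ℤ pE) (𝟙-no (j Nat.≟ i) (Nat.>⇒≢ i<j))) (ℤ.*-zeroˡ pE)))
    where pE = + p *ℤ energy
  ... | tri≈ _ refl _ = trans (pairCorrelation-diagonal i)
                             (sym (trans (cong (_*ℤ pE) (𝟙-yes (i Nat.≟ i) refl)) (ℤ.*-identityˡ pE)))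
    where pE = + p *ℤ energy
  ... | tri> _ _ j<i = trans (trans (pairCorrelation-comm i j) (pairCorrelation-off-diagonal j<i (Nat.<-≤-trans i<L L≤p)))
                             (sym (trans (cong (_*ℤ pE) (𝟙-no (j Nat.≟ i) (Nat.<⇒≢ j<i))) (ℤ.*-zeroˡ pE)))
    where pE = + p *ℤ energy

  -- Expanding the squares, only the L diagonal pairs survive.
  ∑-progressionSum² : ∀ {L} → L ≤ p →
    ∑ p (λ b → ∑ p (λ a → progressionSum L a b *ℤ progressionSum L a b)) ≤ℤ + L *ℤ (+ p *ℤ energy)
  ∑-progressionSum² {L} L≤p = begin
    ∑ p (λ b → ∑ p (λ a → progressionSum L a b *ℤ progressionSum L a b))
      ≡⟨ ∑-cong p (λ {b} _ → ∑-cong p (λ {a} _ → ∑-square L (λ i → G (a + b * i)))) ⟩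
    ∑ p (λ b → ∑ p (λ a → ∑ L (λ i → ∑ L (λ j → X b a i j))))
      ≡⟨ ∑-cong p (λ {b} _ → ∑-comm p L (λ a i → ∑ L (X b a i))) ⟩
    ∑ p (λ b → ∑ L (λ i → ∑ p (λ a → ∑ L (X b a i))))
      ≡⟨ ∑-cong p (λ {b} _ → ∑-cong L (λ {i} _ → ∑-comm p L (λ a j → X b a i j))) ⟩
    ∑ p (λ b → ∑ L (λ i → ∑ L (λ j → ∑ p (λ a → X b a i j))))
      ≡⟨ ∑-comm p L (λ b i → ∑ L (λ j → ∑ p (λ a → X b a i j))) ⟩
    ∑ L (λ i → ∑ p (λ b → ∑ L (λ j → ∑ p (λ a → X b a i j))))
      ≡⟨ ∑-cong L (λ {i} _ → ∑-comm p L (λ b j → ∑ p (λ a → X b a i j))) ⟩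
    ∑ L (λ i → ∑ L (λ j → pairCorrelation i j))
      ≡⟨ ∑-cong L (λ i<L → ∑-cong L (λ j<L → pairCorrelation-orthogonal L≤p i<L j<L)) ⟩
    ∑ L (λ i → ∑ L (λ j → 𝟙 (j Nat.≟ i) *ℤ (+ p *ℤ energy)))
      ≡⟨ ∑-cong L (λ {i} _ → ∑-distribʳ-* L (+ p *ℤ energy) (λ j → 𝟙 (j Nat.≟ i))) ⟩
    ∑ L (λ i → ∑ L (λ j → 𝟙 (j Nat.≟ i)) *ℤ (+ p *ℤ energy))
      ≤⟨ ∑-mono-≤ L (λ {i} _ → ℤ.*-monoʳ-≤-nonNeg (+ p *ℤ energy) {{pEnergy≥0}} (∑-𝟙-≡-≤1 L i)) ⟩
    ∑ L (λ _ → 1ℤ *ℤ (+ p *ℤ energy))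
      ≡⟨ trans (∑-const L _) (cong (+ L *ℤ_) (ℤ.*-identityˡ _)) ⟩
    + L *ℤ (+ p *ℤ energy) ∎
    where
    open ℤ.≤-Reasoning
    X : ℕ → ℕ → ℕ → ℕ → ℤ
    X b a i j = G (a + b * i) *ℤ G (a + b * j)
    pEnergy≥0 = nonNegative (ℤ.≤-trans (ℤ.≤-reflexive (sym (ℤ.*-zeroʳ (+ p)))) (ℤ.*-monoˡ-≤-nonNeg (+ p) energy≥0))

  square-progressionSum-dilate : ∀ L {b} → ¬ b ≈ 0 → (∀ y → G (b * y) ≡ G y) →
    ∑ p (λ a → progressionSum L a b *ℤ progressionSum L a b) ≡
    ∑ p (λ a → progressionSum L a 1 *ℤ progressionSum L a 1)
  square-progressionSum-dilate L {b} b≉0 G-dilate = trans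
    (sym (∑-affine 0 b≉0 (λ a → progressionSum L a b *ℤ progressionSum L a b)
      (λ a≈a′ → cong₂ _*ℤ_ (shift-cong a≈a′) (shift-cong a≈a′))))
    (∑-cong p (λ {x} _ → cong (λ s → s *ℤ s) (∑-cong L (λ {i} _ → dilated x i))))
    where
    shift-cong : ∀ {a a′} → a ≈ a′ → progressionSum L a b ≡ progressionSum L a′ b
    shift-cong a≈a′ = ∑-cong L (λ {i} _ → G-cong (+-cong a≈a′ (≈-refl {b * i})))
    dilated : ∀ x i → G (b * x + b * i) ≡ G (x + 1 * i)
    dilated x i = trans (cong G (sym (Nat.*-distribˡ-+ b x i)))
                        (trans (G-dilate (x + i)) (cong (λ n → G (x + n)) (sym (Nat.*-identityˡ i))))

  ∑-progressionSum²-lower : ∀ L {q} {B : ℕ → Set q} (B? : Decidable B) →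
    (∀ {b} → B b → ¬ b ≈ 0) → (∀ {b} → B b → ∀ y → G (b * y) ≡ G y) →
    ∑ p (λ b → 𝟙 (B? b)) *ℤ ∑ p (λ a → progressionSum L a 1 *ℤ progressionSum L a 1)
      ≤ℤ ∑ p (λ b → ∑ p (λ a → progressionSum L a b *ℤ progressionSum L a b))
  ∑-progressionSum²-lower L {B = B} B? B≉0 B-dilate = ℤ.≤-trans
    (ℤ.≤-reflexive (sym (∑-distribʳ-* p (∑ p (λ a → S² a 1)) (λ b → 𝟙 (B? b)))))
    (∑-mono-≤ p (λ {b} _ → term b (B? b)))
    where
    S² : ℕ → ℕ → ℤ
    S² a b = progressionSum L a b *ℤ progressionSum L a b
    term : ∀ b (d : Dec (B b)) → 𝟙 d *ℤ ∑ p (λ a → S² a 1) ≤ℤ ∑ p (λ a → S² a b)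
    term b (yes Bb) = ℤ.≤-reflexive (trans (ℤ.*-identityˡ _)
                                           (sym (square-progressionSum-dilate L (B≉0 Bb) (B-dilate Bb))))
    term b (no _)   = ℤ.≤-trans (ℤ.≤-reflexive (ℤ.*-zeroˡ (∑ p (λ a → S² a 1))))
                                (∑-nonNeg p (λ {a} _ → i*i≥0 (progressionSum L a b)))

module WindowArithmetic where
  open import Data.Nat.Base
  open import Data.Nat.Properties
  open import Data.Nat.Solver using (module +-*-Solver)
  open +-*-Solver
  open import Relation.Binary.PropositionalEquality

  p≤2[p-1] : ∀ {p} → 1 < p → p ≤ 2 * (p ∸ 1)
  p≤2[p-1] {suc m} (s≤s 1≤m) = subst (λ n → suc m ≤ m + n) (sym (+-identityʳ m)) (+-monoˡ-≤ m 1≤m)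

  -- From h e (L s)² ≤ L p³ s with h, s ≥ k and p - 1 = k ℓ: cancel L s, then k² e L ≤ p³ ≤ k² (2 ℓ)² p.
  exceptional-arithmetic : ∀ {p ℓ k h s e L} → 1 < p → 0 < L → 0 < k → k ≤ h → k ≤ s → k * ℓ ≡ p ∸ 1 →
    h * (e * ((L * s) * (L * s))) ≤ L * (p * (p * p * s)) → e * L ≤ 4 * ℓ * ℓ * p
  exceptional-arithmetic {p} {ℓ} {k} {h} {s} {e} {L} 1<p 0<L 0<k k≤h k≤s kℓ≡p-1 bound =
    *-cancelˡ-≤ (k * k) {{>-nonZero (*-mono-< 0<k 0<k)}} (begin
      k * k * (e * L)        ≡⟨ solve 3 (λ k e L → k :* k :* (e :* L) := (k :* e) :* (L :* k)) refl k e L ⟩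
      (k * e) * (L * k)      ≤⟨ *-mono-≤ (*-monoˡ-≤ e k≤h) (*-monoʳ-≤ L k≤s) ⟩
      (h * e) * (L * s)      ≤⟨ *-cancelˡ-≤ (L * s) {{>-nonZero (*-mono-< 0<L (<-≤-trans 0<k k≤s))}} cancelled ⟩
      p * p * p              ≤⟨ *-monoˡ-≤ p (*-mono-≤ p≤2kℓ p≤2kℓ) ⟩
      (2 * (k * ℓ)) * (2 * (k * ℓ)) * p ≡⟨ solve 3 (λ k ℓ p → (con 2 :* (k :* ℓ)) :* (con 2 :* (k :* ℓ)) :* p
                                                 := k :* k :* (con 4 :* ℓ :* ℓ :* p)) refl k ℓ p ⟩
      k * k * (4 * ℓ * ℓ * p) ∎)
    where
    open ≤-Reasoning
    p≤2kℓ : p ≤ 2 * (k * ℓ)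
    p≤2kℓ = subst (λ n → p ≤ 2 * n) (sym kℓ≡p-1) (p≤2[p-1] 1<p)
    cancelled : L * s * (h * e * (L * s)) ≤ L * s * (p * p * p)
    cancelled = subst₂ _≤_
      (solve 4 (λ h e L s → h :* (e :* ((L :* s) :* (L :* s))) := (L :* s) :* (h :* e :* (L :* s))) refl h e L s)
      (solve 3 (λ L p s → L :* (p :* (p :* p :* s)) := (L :* s) :* (p :* p :* p)) refl L p s) bound

  ^-bound : ∀ n {e L C p} → e ≤ p → 1 ≤ C → e * L ≤ C * p → e ^ suc n * L ≤ C ^ suc n * p ^ suc n
  ^-bound n {e} {L} {C} {p} e≤p 1≤C eL≤Cp = begin
    e * e ^ n * L         ≡⟨ solve 3 (λ e E L → e :* E :* L := E :* (e :* L)) refl e (e ^ n) L ⟩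
    e ^ n * (e * L)       ≤⟨ *-mono-≤ (^-monoˡ-≤ n e≤p) eL≤Cp ⟩
    p ^ n * (C * p)       ≡⟨ solve 3 (λ C p P → P :* (C :* p) := C :* (p :* P)) refl C p (p ^ n) ⟩
    C * p ^ suc n         ≤⟨ *-monoˡ-≤ (p ^ suc n) (m≤m*n C (C ^ n) {{m^n≢0 C n {{>-nonZero 1≤C}}}}) ⟩
    C ^ suc n * p ^ suc n ∎
    where open ≤-Reasoning

module ResidueWindows (p : ℕ) .{{_ : NonZero p}} (isPrime : Prime p)
                      (ℓ : ℕ) .{{_ : NonZero ℓ}} (ℓ∣p-1 : ℓ ∣ p ∸ 1)
                      (r : ℕ) (r<p : r < p) (rˡ≈1 : Congruence._≈_ p (r Nat.^ ℓ) 1) where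
  open Congruence p
  open PrimeCongruence p isPrime
  open PowerResidue p isPrime ℓ ℓ∣p-1
  open IntegerSum
  open import Data.Nat.Base using (_+_; _*_; _^_; _≤_; _%_)
  import Data.Nat.Properties as Nat
  open import Data.Nat.DivMod using (m%n<n)
  open import Data.Product using (_,_)
  open import Data.Sum using (inj₁; inj₂)
  open import Data.Empty using (⊥-elim)
  open import Data.Integer.Base using (+_; -_; ∣_∣; nonNegative)
    renaming (_+_ to _+ℤ_; _-_ to _-ℤ_; _*_ to _*ℤ_; _≤_ to _≤ℤ_)
  import Data.Integer.Properties as ℤ
  open import Data.Integer.Solver using (module +-*-Solver)
  open import Relation.Nullary using (¬_; Dec; yes; no)
  open ≡ using (refl; cong; cong₂; sym; trans)

  S : ℤ
  S = fibre r

  [χ≡r] : ℕ → ℤ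
  [χ≡r] x = 𝟙 (χ x Nat.≟ r)

  G : ℕ → ℤ
  G x = + p *ℤ [χ≡r] x -ℤ S

  G-cong : ∀ {x y} → x ≈ y → G x ≡ G y
  G-cong x≈y = cong (λ c → + p *ℤ 𝟙 (c Nat.≟ r) -ℤ S) (χ-cong x≈y)

  G-dilate : ∀ {b} → χ b ≡ 1 → ∀ y → G (b * y) ≡ G y
  G-dilate χb≡1 y = cong (λ c → + p *ℤ 𝟙 (c Nat.≟ r) -ℤ S) (χ-kernel-* y χb≡1)

  ∑G≡0 : ∑ p G ≡ 0ℤ
  ∑G≡0 = begin
    ∑ p G
      ≡⟨ ∑-distrib-+ p (λ x → + p *ℤ [χ≡r] x) (λ _ → - S) ⟩
    ∑ p (λ x → + p *ℤ [χ≡r] x) +ℤ ∑ p (λ _ → - S)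
      ≡⟨ cong₂ _+ℤ_ (∑-distribˡ-* p (+ p) [χ≡r]) (∑-const p (- S)) ⟩
    + p *ℤ S +ℤ + p *ℤ - S
      ≡⟨ solve 2 (λ a s → a :* s :+ a :* (:- s) := con 0ℤ) refl (+ p) S ⟩
    0ℤ
      ∎
    where
    open ≡.≡-Reasoning
    open +-*-Solver

  open ProgressionSums p isPrime G G-cong ∑G≡0

  energy≤p²S : energy ≤ℤ + p *ℤ + p *ℤ S
  energy≤p²S = begin
    energy
      ≡⟨ ∑-cong p (λ {x} _ → G²-expand ([χ≡r] x) (𝟙*𝟙 (χ x Nat.≟ r))) ⟩
    ∑ p (λ x → α *ℤ [χ≡r] x +ℤ S *ℤ S)
      ≡⟨ ∑-distrib-+ p (λ x → α *ℤ [χ≡r] x) (λ _ → S *ℤ S) ⟩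
    ∑ p (λ x → α *ℤ [χ≡r] x) +ℤ ∑ p (λ _ → S *ℤ S)
      ≡⟨ cong₂ _+ℤ_ (∑-distribˡ-* p α [χ≡r]) (∑-const p (S *ℤ S)) ⟩
    α *ℤ S +ℤ + p *ℤ (S *ℤ S)
      ≡⟨ solve 2 (λ a s → (a :* a :- con (+ 2) :* a :* s) :* s :+ a :* (s :* s) := a :* a :* s :- a :* (s :* s))
               refl (+ p) S ⟩
    + p *ℤ + p *ℤ S -ℤ + p *ℤ (S *ℤ S)
      ≤⟨ ℤ.i-j≤i (+ p *ℤ + p *ℤ S) _ {{nonNegative pS²≥0}} ⟩
    + p *ℤ + p *ℤ S
      ∎
    where
    open ℤ.≤-Reasoning
    open +-*-Solver
    α = + p *ℤ + p -ℤ + 2 *ℤ + p *ℤ S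
    G²-expand : ∀ c → c *ℤ c ≡ c → (+ p *ℤ c -ℤ S) *ℤ (+ p *ℤ c -ℤ S) ≡ α *ℤ c +ℤ S *ℤ S
    G²-expand c c²≡c = begin-equality
      (+ p *ℤ c -ℤ S) *ℤ (+ p *ℤ c -ℤ S)
        ≡⟨ solve 3 (λ a c s → (a :* c :- s) :* (a :* c :- s) := a :* a :* (c :* c) :- con (+ 2) :* a :* s :* c :+ s :* s)
                 refl (+ p) c S ⟩
      + p *ℤ + p *ℤ (c *ℤ c) -ℤ + 2 *ℤ + p *ℤ S *ℤ c +ℤ S *ℤ S
        ≡⟨ cong (λ d → + p *ℤ + p *ℤ d -ℤ + 2 *ℤ + p *ℤ S *ℤ c +ℤ S *ℤ S) c²≡c ⟩
      + p *ℤ + p *ℤ c -ℤ + 2 *ℤ + p *ℤ S *ℤ c +ℤ S *ℤ S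
        ≡⟨ solve 3 (λ a c s → a :* a :* c :- con (+ 2) :* a :* s :* c :+ s :* s := (a :* a :- con (+ 2) :* a :* s) :* c :+ s :* s)
                 refl (+ p) c S ⟩
      α *ℤ c +ℤ S *ℤ S
        ∎
    pS²≥0 : 0ℤ ≤ℤ + p *ℤ (S *ℤ S)
    pS²≥0 = ℤ.≤-trans (ℤ.≤-reflexive (sym (ℤ.*-zeroʳ (+ p)))) (ℤ.*-monoˡ-≤-nonNeg (+ p) (i*i≥0 S))

  module _ (L : ℕ) where
    open import Data.List using (upTo)
    open import Data.List.Relation.Unary.Any using (Any; any?)
    open import Data.List.Relation.Unary.Any.Properties using (applyUpTo⁺)
    open import Relation.Nullary using (¬?)

    misses? : ∀ x₀ → Dec (¬ Any (λ i → χ (x₀ + i) ≡ r) (upTo L))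
    misses? x₀ = ¬? (any? (λ i → χ (x₀ + i) Nat.≟ r) (upTo L))

    missed : ℤ
    missed = ∑ p (λ x₀ → 𝟙 (misses? x₀))

    missed≡exceptional : missed ≡ + exceptional p ℓ r (+ L)
    missed≡exceptional = sym (length-filter≡∑𝟙 misses? (λ x → x) p)

    progressionSum-missed : ∀ {x₀} → ¬ Any (λ i → χ (x₀ + i) ≡ r) (upTo L) →
                            progressionSum L x₀ 1 ≡ + L *ℤ - S
    progressionSum-missed {x₀} miss = trans (∑-cong L G-miss) (∑-const L (- S))
      where
      G-miss : ∀ {i} → i < L → G (x₀ + 1 * i) ≡ - S
      G-miss {i} i<L = begin
        + p *ℤ [χ≡r] (x₀ + 1 * i) -ℤ S   ≡⟨ cong (λ n → + p *ℤ [χ≡r] (x₀ + n) -ℤ S) (Nat.*-identityˡ i) ⟩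
        + p *ℤ [χ≡r] (x₀ + i) -ℤ S       ≡⟨ cong (λ c → + p *ℤ c -ℤ S) (𝟙-no (χ (x₀ + i) Nat.≟ r)
                                                (λ hit → miss (applyUpTo⁺ (λ n → n) hit i<L))) ⟩
        + p *ℤ 0ℤ -ℤ S                   ≡⟨ cong (_-ℤ S) (ℤ.*-zeroʳ (+ p)) ⟩
        0ℤ -ℤ S                          ≡⟨ ℤ.+-identityˡ (- S) ⟩
        - S                              ∎
        where open ≡.≡-Reasoning

    missed-lower : missed *ℤ ((+ L *ℤ S) *ℤ (+ L *ℤ S))
                     ≤ℤ ∑ p (λ a → progressionSum L a 1 *ℤ progressionSum L a 1)
    missed-lower = ℤ.≤-trans (ℤ.≤-reflexive (sym (∑-distribʳ-* p _ (λ x₀ → 𝟙 (misses? x₀)))))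
                             (∑-mono-≤ p (λ {x₀} _ → term x₀ (misses? x₀)))
      where
      open +-*-Solver
      term : ∀ x₀ (d : Dec (¬ Any (λ i → χ (x₀ + i) ≡ r) (upTo L))) →
             𝟙 d *ℤ ((+ L *ℤ S) *ℤ (+ L *ℤ S)) ≤ℤ progressionSum L x₀ 1 *ℤ progressionSum L x₀ 1
      term x₀ (yes miss) = ℤ.≤-reflexive (trans (ℤ.*-identityˡ _)
        (sym (trans (cong (λ w → w *ℤ w) (progressionSum-missed miss))
                    (solve 2 (λ l s → (l :* (:- s)) :* (l :* (:- s)) := (l :* s) :* (l :* s)) refl (+ L) S))))
      term x₀ (no _)     = ℤ.≤-trans (ℤ.≤-reflexive (ℤ.*-zeroˡ ((+ L *ℤ S) *ℤ (+ L *ℤ S))))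
                                     (i*i≥0 (progressionSum L x₀ 1))

    missed-bound : L ≤ p →
      fibre 1 *ℤ (missed *ℤ ((+ L *ℤ S) *ℤ (+ L *ℤ S))) ≤ℤ + L *ℤ (+ p *ℤ (+ p *ℤ + p *ℤ S))
    missed-bound L≤p = begin
      fibre 1 *ℤ (missed *ℤ ((+ L *ℤ S) *ℤ (+ L *ℤ S)))
        ≤⟨ ℤ.*-monoˡ-≤-nonNeg (fibre 1) {{nonNegative (fibre≥0 1)}} missed-lower ⟩
      fibre 1 *ℤ ∑ p (λ a → progressionSum L a 1 *ℤ progressionSum L a 1)
        ≤⟨ ∑-progressionSum²-lower L (λ b → χ b Nat.≟ 1) χ-kernel-≉0 G-dilate ⟩
      ∑ p (λ b → ∑ p (λ a → progressionSum L a b *ℤ progressionSum L a b))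
        ≤⟨ ∑-progressionSum² L≤p ⟩
      + L *ℤ (+ p *ℤ energy)
        ≤⟨ ℤ.*-monoˡ-≤-nonNeg (+ L) (ℤ.*-monoˡ-≤-nonNeg (+ p) energy≤p²S) ⟩
      + L *ℤ (+ p *ℤ (+ p *ℤ + p *ℤ S)) ∎
      where open ℤ.≤-Reasoning

    missed-vanishes : p ≤ L → missed ≡ 0ℤ
    missed-vanishes p≤L with Nat.anyUpTo? (λ y → χ y Nat.≟ r) p
    ... | yes (y , y<p , χy≡r) = ∑-zero p (λ {x₀} _ → 𝟙-no (misses? x₀) (λ miss → miss (hit x₀)))
      where
      hit : ∀ x₀ → Any (λ i → χ (x₀ + i) ≡ r) (upTo L)
      hit x₀ = applyUpTo⁺ (λ n → n) {i = (y + neg x₀) % p} (trans (χ-cong x₀+i≈y) χy≡r)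
                          (Nat.<-≤-trans (m%n<n _ p) p≤L)
        where
        open import Relation.Binary.Reasoning.Setoid setoid
        open import Data.Nat.Solver using () renaming (module +-*-Solver to ℕ-Solver)
        open ℕ-Solver
        x₀+i≈y : x₀ + (y + neg x₀) % p ≈ y
        x₀+i≈y = begin
          x₀ + (y + neg x₀) % p   ≈⟨ +-cong (≈-refl {x₀}) (%-≈ (y + neg x₀)) ⟩
          x₀ + (y + neg x₀)       ≡⟨ solve 3 (λ x y c → x :+ (y :+ c) := y :+ (x :+ c)) refl x₀ y (neg x₀) ⟩
          y + (x₀ + neg x₀)       ≈⟨ +-cong (≈-refl {y}) (+-inverseʳ x₀) ⟩
          y + 0                   ≡⟨ Nat.+-identityʳ y ⟩
          y                       ∎
    ... | no fibre-empty =
      ⊥-elim (Nat.<⇒≱ (Nat.n≢0⇒n>0 k≢0) (ℤ.drop‿+≤+ (ℤ.≤-trans (fibre-lower r<p rˡ≈1) S≤0)))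
      where
      S≤0 : S ≤ℤ 0ℤ
      S≤0 = ℤ.≤-reflexive (∑-zero p (λ {y} y<p → 𝟙-no (χ y Nat.≟ r) (λ χy≡r → fibre-empty (y , y<p , χy≡r))))

    exceptional-bound : 0 < L → L ≤ p → exceptional p ℓ r (+ L) * L ≤ 4 * ℓ * ℓ * p
    exceptional-bound 0<L L≤p = WindowArithmetic.exceptional-arithmetic {e = e} 1<p 0<L (Nat.n≢0⇒n>0 k≢0)
      (+≤⇒≤∣∣ (fibre-lower 1<p (≈-reflexive (Nat.^-zeroˡ ℓ)))) (+≤⇒≤∣∣ (fibre-lower r<p rˡ≈1)) k*ℓ≡p-1
      (ℤ.drop‿+≤+ (≡.subst₂ _≤ℤ_ lhs rhs (missed-bound L≤p)))
      where
      h s e : ℕ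
      h = ∣ fibre 1 ∣
      s = ∣ S ∣
      e = exceptional p ℓ r (+ L)
      h≡ : fibre 1 ≡ + h
      h≡ = sym (ℤ.0≤i⇒+∣i∣≡i (fibre≥0 1))
      s≡ : S ≡ + s
      s≡ = sym (ℤ.0≤i⇒+∣i∣≡i (fibre≥0 r))
      lhs : fibre 1 *ℤ (missed *ℤ ((+ L *ℤ S) *ℤ (+ L *ℤ S))) ≡ + (h * (e * ((L * s) * (L * s))))
      lhs = begin
        fibre 1 *ℤ (missed *ℤ ((+ L *ℤ S) *ℤ (+ L *ℤ S)))
          ≡⟨ cong₂ (λ a b → a *ℤ (b *ℤ ((+ L *ℤ S) *ℤ (+ L *ℤ S)))) h≡ missed≡exceptional ⟩
        + h *ℤ (+ e *ℤ ((+ L *ℤ S) *ℤ (+ L *ℤ S)))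
          ≡⟨ cong (λ σ → + h *ℤ (+ e *ℤ ((+ L *ℤ σ) *ℤ (+ L *ℤ σ)))) s≡ ⟩
        + h *ℤ (+ e *ℤ ((+ L *ℤ + s) *ℤ (+ L *ℤ + s)))
          ≡⟨ sym (trans (ℤ.pos-* h _) (cong (+ h *ℤ_) (trans (ℤ.pos-* e _) (cong (+ e *ℤ_)
               (trans (ℤ.pos-* (L * s) _) (cong₂ _*ℤ_ (ℤ.pos-* L s) (ℤ.pos-* L s))))))) ⟩
        + (h * (e * ((L * s) * (L * s))))
          ∎
        where open ≡.≡-Reasoning
      rhs : + L *ℤ (+ p *ℤ (+ p *ℤ + p *ℤ S)) ≡ + (L * (p * (p * p * s)))
      rhs = begin
        + L *ℤ (+ p *ℤ (+ p *ℤ + p *ℤ S))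
          ≡⟨ cong (λ σ → + L *ℤ (+ p *ℤ (+ p *ℤ + p *ℤ σ))) s≡ ⟩
        + L *ℤ (+ p *ℤ (+ p *ℤ + p *ℤ + s))
          ≡⟨ sym (trans (ℤ.pos-* L _) (cong (+ L *ℤ_) (trans (ℤ.pos-* p _)
               (cong (+ p *ℤ_) (trans (ℤ.pos-* (p * p) s) (cong (_*ℤ + s) (ℤ.pos-* p p))))))) ⟩
        + (L * (p * (p * p * s)))
          ∎
        where open ≡.≡-Reasoning

  exceptional*L≤4ℓ²p : ∀ L → exceptional p ℓ r (+ L) * L ≤ 4 * ℓ * ℓ * p
  exceptional*L≤4ℓ²p zero = ≡.subst (_≤ 4 * ℓ * ℓ * p) (sym (Nat.*-zeroʳ (exceptional p ℓ r (+ 0)))) z≤n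
  exceptional*L≤4ℓ²p L@(suc _) with Nat.≤-total L p
  ... | inj₁ L≤p = exceptional-bound L (s≤s z≤n) L≤p
  ... | inj₂ p≤L = ≡.subst (λ e → e * L ≤ 4 * ℓ * ℓ * p) (sym exceptional≡0) z≤n
    where
    exceptional≡0 : exceptional p ℓ r (+ L) ≡ 0
    exceptional≡0 = ℤ.+-injective (trans (sym (missed≡exceptional L)) (missed-vanishes L p≤L))

open import Data.Nat using (ℕ; _≤_; _<_; _^_; _*_; _∸_; NonZero)
open import Data.Nat.Divisibility using (_∣_)
open import Data.Nat.Primality using (Prime)
open import Data.Nat.DivMod using (_%_)
open import Data.Integer using (ℤ; +_) renaming (_≤_ to _≤ℤ_; _*_ to _*ℤ_)
open import Data.Product using (∃; _×_)
open import Relation.Binary.PropositionalEquality using (_≡_)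

open import Data.Nat.Base using (z≤n; s≤s; >-nonZero⁻¹)
import Data.Nat.Properties as Nat
open import Data.Nat.DivMod using (m<n⇒m%n≡m)
import Data.Integer as ℤ
import Data.Integer.Properties as ℤ
open import Data.List using (upTo)
open import Data.List.Properties using (length-filter; length-upTo)
open import Data.Product using (_,_)
open import Relation.Binary.PropositionalEquality using (sym; trans; subst)

exceptional≤p : ∀ p ℓ .{{_ : NonZero p}} .{{_ : NonZero ℓ}} r L → exceptional p ℓ r L ≤ p
exceptional≤p p ℓ r L = Nat.≤-trans (length-filter _ (upTo p)) (Nat.≤-reflexive (length-upTo p))

1≤4*ℓ*ℓ : ∀ ℓ .{{_ : NonZero ℓ}} → 1 ≤ 4 * ℓ * ℓ
1≤4*ℓ*ℓ ℓ = Nat.*-mono-≤ {1} {4 * ℓ} (Nat.*-mono-≤ {1} {4} (s≤s z≤n) (>-nonZero⁻¹ ℓ)) (>-nonZero⁻¹ ℓ)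

exceptional^7*L≤ : ∀ p .{{_ : NonZero p}} → Prime p → ∀ ℓ .{{_ : NonZero ℓ}} → ℓ ∣ p ∸ 1 →
                   ∀ r → r < p → (r ^ ℓ) % p ≡ 1 →
                   ∀ L → + (exceptional p ℓ r L ^ 7) *ℤ L ≤ℤ + ((4 * ℓ * ℓ) ^ 7 * p ^ 7)
exceptional^7*L≤ p isPrime ℓ ℓ∣p-1 r r<p rˡ≡1 (+ L) =
  subst (_≤ℤ _) (ℤ.pos-* (exceptional p ℓ r (+ L) ^ 7) L) (ℤ.+≤+
    (WindowArithmetic.^-bound 6 (exceptional≤p p ℓ r (+ L)) (1≤4*ℓ*ℓ ℓ)
      (ResidueWindows.exceptional*L≤4ℓ²p p isPrime ℓ ℓ∣p-1 r r<p rˡ≈1 L)))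
  where rˡ≈1 = trans rˡ≡1 (sym (m<n⇒m%n≡m (PrimeCongruence.1<p p isPrime)))
exceptional^7*L≤ p isPrime ℓ ℓ∣p-1 r r<p rˡ≡1 ℤ.-[1+ m ] = ℤ.≤-trans
  (ℤ.≤-trans (ℤ.*-monoˡ-≤-nonNeg (+ e⁷) (ℤ.-≤+ {m} {0})) (ℤ.≤-reflexive (ℤ.*-zeroʳ (+ e⁷))))
  (ℤ.+≤+ z≤n)
  where e⁷ = exceptional p ℓ r ℤ.-[1+ m ] ^ 7

corollary4 : (ℓ : ℕ) → .{{_ : NonZero ℓ}} → 2 ≤ ℓ →
    (L : ℕ → ℤ) →
    ((M : ℕ) → ∃ λ N → (p : ℕ) → N ≤ p → + M ≤ℤ L p) →
    ∃ λ C → ∃ λ p₀ →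
      (p : ℕ) → .{{_ : NonZero p}} → Prime p → ℓ ∣ p ∸ 1 → p₀ ≤ p →
      (r : ℕ) → r < p → (r ^ ℓ) % p ≡ 1 →
      + (exceptional p ℓ r (L p) ^ 7) *ℤ L p ≤ℤ + (C ^ 7 * p ^ 7)
corollary4 ℓ _ L _ = 4 * ℓ * ℓ , 0 , λ p isPrime ℓ∣p-1 _ r r<p rˡ≡1 →
  exceptional^7*L≤ p isPrime ℓ ℓ∣p-1 r r<p rˡ≡1 (L p)
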